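{- Consider any execution of the procedure Explore described below on a finite unfolding $\mathfrak U$. Every path $b_0\triangleright b_1\triangleright b_2\triangleright\cdots$ in its call graph starting from the root $b_0$ is finite.
   Context: $\mathfrak U=(E,<,\#,h)$ is a finite labelled event structure (causality $<$ a strict partial order, conflict $\#$ symmetric irreflexive and inherited along $<$) with a minimal event $\bot$ (the unfolding of a system under an independence relation); a configuration is a finite causally closed conflict-free set of events; $[e]=\{e'\le e\}$, $\lceil e\rceil=\{e'<e\}$; $e\#_ie'$ if $e\#e'$ and both $\lceil e\rceil\cup[e']$ and $[e]\cup\lceil e'\rceil$ are configurations. $\mathrm{ex}(C)=\{e\notin C:\lceil e\rceil\subseteq C\}$, $\mathrm{en}(C)=\{e\in\mathrm{ex}(C):C\cup\{e\}\text{ a configuration}\}$. For $U\subseteq E$, $\#_U(e)=\{e'\in U:e\#_ie'\}$, $Q_{C,D,U}=C\cup D\cup\bigcup_{e\in C\cup D,\,e'\in\#_U(e)}[e']$. An alternative to $D$ after $C$ (w.r.t. $U$) is a configuration $J\subseteq U$ with $C\cup J$ a configuration and, for each $e\in D$, some $e'\in C\cup J$ in $\#_U(e)$; $\mathrm{Alt}(X,Y)$ is the set of all alternatives to $Y$ after $X$ w.r.t. the current $U$. Algorithm: global $U$ (initially $\{\bot\}$), $G$ (initially $\emptyset$); start with $\mathrm{Explore}(\{\bot\},\emptyset,\emptyset)$. $\mathrm{Explore}(C,D,A)$: (1) add $\mathrm{ex}(C)$ to $U$; (2) if $\mathrm{en}(C)\cap U=\emptyset$, return; (3) if $A=\emptyset$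 choose any $e\in\mathrm{en}(C)\cap U$, else any $e\in A\cap\mathrm{en}(C)\cap U$; (4) call $\mathrm{Explore}(C\cup\{e\},D,A\setminus\{e\})$; (5) if some $J\in\mathrm{Alt}(C,D\cup\{e\})$ exists, call $\mathrm{Explore}(C,D\cup\{e\},J\setminus C)$; (6) move $\{e\}\setminus Q_{C,D,U}$ from $U$ to $G$ and, for each $\hat e\in\#_U(e)$, move $[\hat e]\setminus Q_{C,D,U}$ from $U$ to $G$. Call graph: nodes are tuples $(C,D,A,e)$ such that $\mathrm{Explore}(C,D,A)$ was called and $e$ is the event chosen in step (3) (or $\bot$ if the call returned at step (2)); $b\triangleright_l b'$ (resp. $\triangleright_r$) if the call of $b$ issues the call of $b'$ at step (4) (resp. (5)); $\triangleright=\triangleright_l\cup\triangleright_r$; root $b_0=(\{\bot\},\emptyset,\emptyset,\bot)$. -}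

module Defs where

open import Data.Nat using (ℕ; suc)
open import Data.Fin using (Fin)
open import Data.Fin.Subset
  using (Subset; _∈_; _∉_; _∪_; _─_; _-_; ⁅_⁆; Empty)
  renaming (⊥ to ∅)
open import Data.List using (List; []; _∷_; _++_)
open import Data.Product using (Σ; _×_; _,_; ∃)
open import Data.Sum using (_⊎_)
open import Relation.Nullary using (¬_)
open import Relation.Binary.PropositionalEquality using (_≡_)

record EventStructure (n : ℕ) : Set₁ where
  field
    _<_      : Fin n → Fin n → Set
    <-irrefl : ∀ e → ¬ (e < e)
    <-trans  : ∀ {e e' e''} → e < e' → e' < e'' → e < e''
    _#_      : Fin n → Fin n → Set
    #-sym    : ∀ {e e'} → e # e' → e' # e
    #-irrefl : ∀ e → ¬ (e # e)
    #-inh    : ∀ {e e' e''} → e # e' → e' < e'' → e # e''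
    Act      : Set
    h        : Fin n → Act
    bot      : Fin n
    bot-min  : ∀ e → ¬ (e ≡ bot) → bot < e

module _ {n : ℕ} (E : EventStructure n) where
  open EventStructure E

  _≤ₑ_ : Fin n → Fin n → Set
  e ≤ₑ e' = e ≡ e' ⊎ e < e'

  -- configurations of a set given as a predicate (causally closed,
  -- conflict-free; finiteness is automatic)
  IsConfigP : (Fin n → Set) → Set
  IsConfigP P = (∀ e e' → P e → e' < e → P e')
              × (∀ e e' → P e → P e' → ¬ (e # e'))

  IsConfig : Subset n → Set
  IsConfig C = IsConfigP (_∈ C)

  InEx : Subset n → Fin n → Set
  InEx C e = e ∉ C × (∀ e' → e' < e → e' ∈ C)

  InEn : Subset n → Fin n → Set
  InEn C e = InEx C e × IsConfig (C ∪ ⁅ e ⁆)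

  _#ᵢ_ : Fin n → Fin n → Set
  e #ᵢ e' = e # e'
          × IsConfigP (λ x → x < e ⊎ x ≤ₑ e')
          × IsConfigP (λ x → x ≤ₑ e ⊎ x < e')

  InConfU : Subset n → Fin n → Fin n → Set
  InConfU U e e' = e' ∈ U × e #ᵢ e'

  InQ : Subset n → Subset n → Subset n → Fin n → Set
  InQ U C D x = x ∈ C ⊎ x ∈ D
              ⊎ Σ (Fin n) λ e → Σ (Fin n) λ e' →
                  (e ∈ C ⊎ e ∈ D) × InConfU U e e' × x ≤ₑ e'

  -- x is moved from U to G at step (6) of Explore(C,D,·) with chosen e
  -- (all of Q and #_U(e) are computed with U at the start of step (6))
  Removed : Subset n → Subset n → Subset n → Fin n → Fin n → Set
  Removed U C D e x =
    (x ≡ e ⊎ Σ (Fin n) λ ê → InConfU U e ê × x ≤ₑ ê) × ¬ InQ U C D x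

  Alt : Subset n → Subset n → Subset n → Subset n → Set
  Alt U C D J = (∀ x → x ∈ J → x ∈ U)
              × IsConfig J
              × IsConfig (C ∪ J)
              × (∀ d → d ∈ D → Σ (Fin n) λ e' → (e' ∈ C ⊎ e' ∈ J) × InConfU U d e')

record Node (n : ℕ) : Set where
  constructor node
  field
    C D A : Subset n
    ev    : Fin n     -- event chosen at step (3), or ⊥ if returned at (2)

-- position within a running call: next step to execute is (4), (5) or (6)
data Phase : Set where
  ph4 ph5 ph6 : Phase

Frame : ℕ → Set
Frame n = Node n × Phase

record State (n : ℕ) : Set where
  constructor state
  field
    U G   : Subset n
    stack : List (Frame n)

data Label (n : ℕ) : Set where
  callL  : Node n → Node n → Label n
  callR  : Node n → Node n → Label n
  silent : Label n

module _ {n : ℕ} (E : EventStructure n) where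
  open EventStructure E

  -- Invoking Explore(C,D,A) with current global U: steps (1)-(3).
  -- Produces the call-graph node, the new U and the frame pushed (if any).
  data Invoke (U C D A : Subset n) : Node n → Subset n → List (Frame n) → Set where
    returns : ∀ {U'} →
      (∀ x → (x ∈ U' → x ∈ U ⊎ InEx E C x) × (x ∈ U ⊎ InEx E C x → x ∈ U')) →
      (∀ x → InEn E C x → x ∉ U') →
      Invoke U C D A (node C D A bot) U' []
    chooses : ∀ {U'} (e : Fin n) →
      (∀ x → (x ∈ U' → x ∈ U ⊎ InEx E C x) × (x ∈ U ⊎ InEx E C x → x ∈ U')) →
      InEn E C e → e ∈ U' → (Empty A ⊎ e ∈ A) →
      Invoke U C D A (node C D A e) U' ((node C D A e , ph4) ∷ [])

  data Step : State n → Label n → State n → Set where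
    stepL : ∀ {U G C D A e st b' U' new} →
      Invoke U (C ∪ ⁅ e ⁆) D (A - e) b' U' new →
      Step (state U G ((node C D A e , ph4) ∷ st))
           (callL (node C D A e) b')
           (state U' G (new ++ ((node C D A e , ph5) ∷ st)))
    stepR : ∀ {U G C D A e st b' U' new} (J : Subset n) →
      Alt E U C (D ∪ ⁅ e ⁆) J →
      Invoke U C (D ∪ ⁅ e ⁆) (J ─ C) b' U' new →
      Step (state U G ((node C D A e , ph5) ∷ st))
           (callR (node C D A e) b')
           (state U' G (new ++ ((node C D A e , ph6) ∷ st)))
    stepR-none : ∀ {U G C D A e st} →
      (∀ J → ¬ Alt E U C (D ∪ ⁅ e ⁆) J) →
      Step (state U G ((node C D A e , ph5) ∷ st))
           silent
           (state U G ((node C D A e , ph6) ∷ st))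
    stepF : ∀ {U G U' G' C D A e st} →
      (∀ x → (x ∈ U' → x ∈ U × ¬ Removed E U C D e x)
           × (x ∈ U × ¬ Removed E U C D e x → x ∈ U')) →
      (∀ x → (x ∈ G' → x ∈ G ⊎ Removed E U C D e x)
           × (x ∈ G ⊎ Removed E U C D e x → x ∈ G')) →
      Step (state U G ((node C D A e , ph6) ∷ st)) silent (state U' G' st)
    -- stuttering (allows finite / halted executions)
    stutter : ∀ {s} → Step s silent s

  record Execution : Set where
    field
      root  : Node n
      s     : ℕ → State n
      lab   : ℕ → Label n
      init  : Invoke ⁅ bot ⁆ ⁅ bot ⁆ ∅ ∅ root
                (State.U (s 0)) (State.stack (s 0))
      initG : State.G (s 0) ≡ ∅
      step  : ∀ i → Step (s i) (lab i) (s (suc i))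

  CallEdge : Execution → Node n → Node n → Set
  CallEdge X b b' = ∃ λ i → Execution.lab X i ≡ callL b b'
                       ⊎ Execution.lab X i ≡ callR b b'

-- Every frame on the call stack of Explore(C,D,A) with chosen event e satisfies:
-- C ∪ A is conflict-free, every event of D is in conflict with some event of
-- C ∪ A, and e is enabled at C with either A = ∅ or e ∈ A.  The left call adds
-- e to C, and the right call adds e to D; e ∉ D because e lies in the
-- conflict-free set C ∪ {e} ∪ (A ∖ {e}) that every event of D conflicts with.
-- Hence |C| + |D| strictly increases along every call edge, yet it is at most 2n.
module Submission where

open import Defs
open import Data.Nat using (ℕ; zero; suc; _+_; _≤_; _<_; z≤n; s≤s)
open import Data.Nat.Properties
  using (+-monoˡ-<; +-monoʳ-<; +-mono-≤; ≤-trans; <-≤-trans; ≤-reflexive; <-irrefl)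
open import Data.Fin using (Fin)
open import Data.Fin.Properties using (_≟_)
open import Data.Fin.Subset
  using (Subset; _∈_; _∉_; _⊆_; _∪_; _─_; _-_; ⁅_⁆; Empty; ∣_∣)
  renaming (⊥ to ∅)
open import Data.Fin.Subset.Properties
  using ( x∈p∪q⁺; x∈p∪q⁻; x∈⁅x⁆; x∈⁅y⁆⇒x≡y; ∉⊥; x∈p∧x≢y⇒x∈p-y
        ; x∈p∧x∉q⇒x∈p─q; p─q⊆p; p⊆p∪q; p⊂q⇒∣p∣<∣q∣; ∣p∣≤n; _∈?_ )
open import Data.List.Relation.Unary.All using (All; []; _∷_)
open import Data.List.Relation.Unary.All.Properties using (++⁺)
open import Data.Product using (Σ; _×_; _,_; proj₂; ∃)
open import Data.Sum using (_⊎_; inj₁; inj₂)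
open import Data.Empty using (⊥-elim)
open import Relation.Nullary using (¬_; yes; no)
open import Relation.Binary.PropositionalEquality using (_≡_; refl; sym)
open import Function using (_∘_)

x∉p⇒∣p∣<∣p∪⁅x⁆∣ : ∀ {n} {p : Subset n} {x} → x ∉ p → ∣ p ∣ < ∣ p ∪ ⁅ x ⁆ ∣
x∉p⇒∣p∣<∣p∪⁅x⁆∣ {x = x} x∉p =
  p⊂q⇒∣p∣<∣q∣ (p⊆p∪q ⁅ x ⁆ , x , x∈p∪q⁺ (inj₂ (x∈⁅x⁆ x)) , x∉p)

module _ {n : ℕ} {p q : Subset n} where

  p∪q⊆p∪⁅x⁆∪[q-x] : ∀ x → p ∪ q ⊆ (p ∪ ⁅ x ⁆) ∪ (q - x)
  p∪q⊆p∪⁅x⁆∪[q-x] x {y} y∈ with x∈p∪q⁻ p q y∈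
  ... | inj₁ y∈p = x∈p∪q⁺ (inj₁ (x∈p∪q⁺ (inj₁ y∈p)))
  ... | inj₂ y∈q with y ≟ x
  ...   | yes refl = x∈p∪q⁺ (inj₁ (x∈p∪q⁺ (inj₂ (x∈⁅x⁆ x))))
  ...   | no y≢x   = x∈p∪q⁺ (inj₂ (x∈p∧x≢y⇒x∈p-y y∈q y≢x))

  Empty[q]⇒p∪⁅x⁆∪[q-x]⊆p∪⁅x⁆ : ∀ {x} → Empty q → (p ∪ ⁅ x ⁆) ∪ (q - x) ⊆ p ∪ ⁅ x ⁆
  Empty[q]⇒p∪⁅x⁆∪[q-x]⊆p∪⁅x⁆ {x} q∅ {y} y∈ with x∈p∪q⁻ (p ∪ ⁅ x ⁆) (q - x) y∈
  ... | inj₁ y∈p∪x = y∈p∪x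
  ... | inj₂ y∈q-x = ⊥-elim (q∅ (y , p─q⊆p q ⁅ x ⁆ y∈q-x))

  x∈q⇒p∪⁅x⁆∪[q-x]⊆p∪q : ∀ {x} → x ∈ q → (p ∪ ⁅ x ⁆) ∪ (q - x) ⊆ p ∪ q
  x∈q⇒p∪⁅x⁆∪[q-x]⊆p∪q {x} x∈q {y} y∈ with x∈p∪q⁻ (p ∪ ⁅ x ⁆) (q - x) y∈
  ... | inj₂ y∈q-x = x∈p∪q⁺ (inj₂ (p─q⊆p q ⁅ x ⁆ y∈q-x))
  ... | inj₁ y∈p∪x with x∈p∪q⁻ p ⁅ x ⁆ y∈p∪x
  ...   | inj₁ y∈p = x∈p∪q⁺ (inj₁ y∈p)
  ...   | inj₂ y∈x with x∈⁅y⁆⇒x≡y x y∈x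
  ...     | refl = x∈p∪q⁺ (inj₂ x∈q)

  p∪[q─p]⊆p∪q : p ∪ (q ─ p) ⊆ p ∪ q
  p∪[q─p]⊆p∪q {y} y∈ with x∈p∪q⁻ p (q ─ p) y∈
  ... | inj₁ y∈p   = x∈p∪q⁺ (inj₁ y∈p)
  ... | inj₂ y∈q─p = x∈p∪q⁺ (inj₂ (p─q⊆p q p y∈q─p))

  p∪q⊆p∪[q─p] : p ∪ q ⊆ p ∪ (q ─ p)
  p∪q⊆p∪[q─p] {y} y∈ with x∈p∪q⁻ p q y∈
  ... | inj₁ y∈p = x∈p∪q⁺ (inj₁ y∈p)
  ... | inj₂ y∈q with y ∈? p
  ...   | yes y∈p = x∈p∪q⁺ (inj₁ y∈p)
  ...   | no y∉p  = x∈p∪q⁺ (inj₂ (x∈p∧x∉q⇒x∈p─q y∈q y∉p))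

no-bounded-ascent : ∀ (g : ℕ → ℕ) N → (∀ i → g i ≤ N) → ¬ (∀ i → g i < g (suc i))
no-bounded-ascent g N bounded ascending =
  <-irrefl refl (≤-trans (i≤g[i] (suc N)) (bounded (suc N)))
  where
  i≤g[i] : ∀ i → i ≤ g i
  i≤g[i] zero    = z≤n
  i≤g[i] (suc i) = ≤-trans (s≤s (i≤g[i] i)) (ascending i)

module _ {n : ℕ} (E : EventStructure n) where
  open EventStructure E using (_#_; #-irrefl; bot)

  ConflictFree : Subset n → Set
  ConflictFree S = ∀ x y → x ∈ S → y ∈ S → ¬ (x # y)

  ExcludedBy : Subset n → Subset n → Set
  ExcludedBy D S = ∀ d → d ∈ D → ∃ λ e → e ∈ S × d # e

  conflictFree-⊆ : ∀ {S T} → S ⊆ T → ConflictFree T → ConflictFree S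
  conflictFree-⊆ S⊆T cf x y x∈S y∈S = cf x y (S⊆T x∈S) (S⊆T y∈S)

  excludedBy-⊆ : ∀ {D S T} → S ⊆ T → ExcludedBy D S → ExcludedBy D T
  excludedBy-⊆ S⊆T ex d d∈D with ex d d∈D
  ... | e , e∈S , d#e = e , S⊆T e∈S , d#e

  WellFormed : Subset n → Subset n → Subset n → Set
  WellFormed C D A = ConflictFree (C ∪ A) × ExcludedBy D (C ∪ A)

  -- the side conditions of step (3) recorded by Invoke
  Chosen : Subset n → Subset n → Fin n → Set
  Chosen C A e = InEn E C e × (Empty A ⊎ e ∈ A)

  wellFormed⇒∉ : ∀ {C D A x} → WellFormed C D A → x ∈ C ∪ A → x ∉ D
  wellFormed⇒∉ (cf , ex) x∈C∪A x∈D with ex _ x∈D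
  ... | e , e∈C∪A , x#e = cf _ e x∈C∪A e∈C∪A x#e

  FrameOK : Frame n → Set
  FrameOK (node C D A e , _) = WellFormed C D A × Chosen C A e

  wellFormed-left : ∀ {C D A e} → WellFormed C D A → Chosen C A e →
                    WellFormed (C ∪ ⁅ e ⁆) D (A - e)
  wellFormed-left {e = e} (_ , ex) (en , inj₁ A∅) =
    conflictFree-⊆ (Empty[q]⇒p∪⁅x⁆∪[q-x]⊆p∪⁅x⁆ A∅) (proj₂ (proj₂ en)) ,
    excludedBy-⊆ (p∪q⊆p∪⁅x⁆∪[q-x] e) ex
  wellFormed-left {e = e} (cf , ex) (_ , inj₂ e∈A) =
    conflictFree-⊆ (x∈q⇒p∪⁅x⁆∪[q-x]⊆p∪q e∈A) cf ,
    excludedBy-⊆ (p∪q⊆p∪⁅x⁆∪[q-x] e) ex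

  chosen∉D : ∀ {C D A e} → WellFormed C D A → Chosen C A e → e ∉ D
  chosen∉D {e = e} wf ch =
    wellFormed⇒∉ (wellFormed-left wf ch) (x∈p∪q⁺ (inj₁ (x∈p∪q⁺ (inj₂ (x∈⁅x⁆ e)))))

  wellFormed-right : ∀ {U C D J} → Alt E U C D J → WellFormed C D (J ─ C)
  wellFormed-right {C = C} {D} {J} (_ , _ , C∪J-config , alt) =
    conflictFree-⊆ p∪[q─p]⊆p∪q (proj₂ C∪J-config) ,
    excludedBy-⊆ p∪q⊆p∪[q─p] excluded
    where
    excluded : ExcludedBy D (C ∪ J)
    excluded d d∈D with alt d d∈D
    ... | e , e∈C⊎e∈J , _ , d#e , _ = e , x∈p∪q⁺ e∈C⊎e∈J , d#e

  wellFormed-root : WellFormed ⁅ bot ⁆ ∅ ∅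
  wellFormed-root = conflictFree , λ d d∈∅ → ⊥-elim (∉⊥ d∈∅)
    where
    conflictFree : ConflictFree (⁅ bot ⁆ ∪ ∅)
    conflictFree x y x∈ y∈ with x∈p∪q⁻ ⁅ bot ⁆ ∅ x∈ | x∈p∪q⁻ ⁅ bot ⁆ ∅ y∈
    ... | inj₂ x∈∅ | _        = ⊥-elim (∉⊥ x∈∅)
    ... | _        | inj₂ y∈∅ = ⊥-elim (∉⊥ y∈∅)
    ... | inj₁ x∈⊥ | inj₁ y∈⊥ with x∈⁅y⁆⇒x≡y bot x∈⊥ | x∈⁅y⁆⇒x≡y bot y∈⊥
    ...   | refl | refl = #-irrefl bot

  invoke-frameOK : ∀ {U C D A b U′ new} → WellFormed C D A →
                   Invoke E U C D A b U′ new → All FrameOK new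
  invoke-frameOK _  (returns _ _)          = []
  invoke-frameOK wf (chooses _ _ en _ ch) = (wf , en , ch) ∷ []

  weight : Node n → ℕ
  weight b = ∣ Node.C b ∣ + ∣ Node.D b ∣

  invoke-weight : ∀ {U C D A b U′ new} → Invoke E U C D A b U′ new →
                  weight b ≡ ∣ C ∣ + ∣ D ∣
  invoke-weight (returns _ _)         = refl
  invoke-weight (chooses _ _ _ _ _)   = refl

  weight≤2n : ∀ b → weight b ≤ n + n
  weight≤2n b = +-mono-≤ (∣p∣≤n (Node.C b)) (∣p∣≤n (Node.D b))

  step-frameOK : ∀ {s l s′} → All FrameOK (State.stack s) → Step E s l s′ →
                 All FrameOK (State.stack s′)
  step-frameOK ((wf , ch) ∷ oks) (stepL inv) =
    ++⁺ (invoke-frameOK (wellFormed-left wf ch) inv) ((wf , ch) ∷ oks)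
  step-frameOK (ok ∷ oks) (stepR _ alt inv) =
    ++⁺ (invoke-frameOK (wellFormed-right alt) inv) (ok ∷ oks)
  step-frameOK (ok ∷ oks) (stepR-none _) = ok ∷ oks
  step-frameOK (_ ∷ oks)  (stepF _ _)    = oks
  step-frameOK oks        stutter        = oks

  call-weight-< : ∀ {s l s′ b b′} → All FrameOK (State.stack s) → Step E s l s′ →
                  l ≡ callL b b′ ⊎ l ≡ callR b b′ → weight b < weight b′
  call-weight-< ((_ , ((e∉C , _) , _) , _) ∷ _) (stepL inv) (inj₁ refl) =
    <-≤-trans (+-monoˡ-< _ (x∉p⇒∣p∣<∣p∪⁅x⁆∣ e∉C))
              (≤-reflexive (sym (invoke-weight inv)))
  call-weight-< ((wf , ch) ∷ _) (stepR _ _ inv) (inj₂ refl) =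
    <-≤-trans (+-monoʳ-< _ (x∉p⇒∣p∣<∣p∪⁅x⁆∣ (chosen∉D wf ch)))
              (≤-reflexive (sym (invoke-weight inv)))
  call-weight-< _ (stepL _)      (inj₂ ())
  call-weight-< _ (stepR _ _ _)  (inj₁ ())
  call-weight-< _ (stepR-none _) (inj₁ ())
  call-weight-< _ (stepR-none _) (inj₂ ())
  call-weight-< _ (stepF _ _)    (inj₁ ())
  call-weight-< _ (stepF _ _)    (inj₂ ())
  call-weight-< _ stutter        (inj₁ ())
  call-weight-< _ stutter        (inj₂ ())

  execution-frameOK : (X : Execution E) →
                      ∀ i → All FrameOK (State.stack (Execution.s X i))
  execution-frameOK X zero    = invoke-frameOK wellFormed-root (Execution.init X)
  execution-frameOK X (suc i) = step-frameOK (execution-frameOK X i) (Execution.step X i)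

  callEdge-weight-< : ∀ (X : Execution E) {b b′} → CallEdge E X b b′ → weight b < weight b′
  callEdge-weight-< X (i , call) =
    call-weight-< (execution-frameOK X i) (Execution.step X i) call

lemma9 : ∀ {n} (E : EventStructure n) (X : Execution E) →
         ¬ (Σ (ℕ → Node n) λ f →
              f 0 ≡ Execution.root X × (∀ i → CallEdge E X (f i) (f (suc i))))
lemma9 {n} E X (f , _ , edges) =
  no-bounded-ascent (weight E ∘ f) (n + n) (weight≤2n E ∘ f)
                    (callEdge-weight-< E X ∘ edges)
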